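{- Let $\mathcal{F}$ be a union-closed family of finite sets with $\emptyset\in\mathcal{F}$ such that every member of $J(\mathcal{F})$ has one or two elements, let $U=\{a,b\}\in J(\mathcal{F})$ with $a\neq b$, and suppose $\mathcal{F}=\mathcal{N}^3_{\mathcal{F}}(U)$. Let $\mathcal{H}$ be a nonempty order filter (up-set) of $2^{N^2\setminus U}$ such that $|E(X)|=1$ for every minimal member $X$ of $\mathcal{H}$. If $X\in\mathcal{H}$ and $Y\subseteq U$, then $\pi_{\mathcal{F}}(X\cup Y)\cap U=Y$.
   Context: $J(\mathcal{F})$ is the set of union generators of $\mathcal{F}$ (nonempty $V\in\mathcal{F}$ not equal to the union of the members of $\mathcal{F}$ properly contained in $V$). $N_{\mathcal{F}}(Z)=Z\cup\bigcup\{V\in J(\mathcal{F}):V\cap Z\neq\emptyset\}$, $N=N_{\mathcal{F}}(U)$, $N^2=N_{\mathcal{F}}(N)$. $\mathcal{N}_{\mathcal{F}}(W)$ is the family of all unions of subfamilies of $\{V\in J(\mathcal{F}):V\cap W\neq\emptyset\}$ (empty union $=\emptyset$), $\mathcal{N}^3_{\mathcal{F}}(U)=\mathcal{N}_{\mathcal{F}}(\bigcup\mathcal{N}_{\mathcal{F}}(U))$. $\pi_{\mathcal{F}}(Z)=\bigcup\{V\in\mathcal{F}:V\subseteq Z\}$. For $X$ with $X\cap U=\emptyset$, $E(X)$ is the set of $W\subseteq U$ with $\pi_{\mathcal{F}}(X\cup W)\cap U=W$ and $\pi_{\mathcal{F}}(X\cup W)\supseteq\pi_{\mathcal{F}}(X\cup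 U)\setminus U$. -}

module Defs where

open import Data.Nat using (ℕ; zero; suc)
open import Data.Bool using (Bool; true; false; _∧_; not)
open import Data.List using (List; []; _∷_; _++_; map; filter; filterᵇ; length)
open import Data.List.Relation.Unary.All using (All)
open import Data.Fin using (Fin)
open import Data.Fin.Subset using (Subset; _∈_; _∩_; _∪_; _─_; ⋃; ⊥; _⊂_; _⊆_; ∣_∣; ⁅_⁆; inside; outside)
open import Data.Fin.Subset.Properties using (_⊆?_; _⊂?_)
open import Data.Vec using ([]; _∷_)
open import Data.Vec.Properties using (≡-dec)
import Data.Bool.Properties as BoolP
open import Data.Product using (Σ; ∃; _×_)
open import Relation.Nullary.Decidable using (does; Dec)
open import Data.Empty renaming (⊥ to ⊥₀)
open import Relation.Binary.PropositionalEquality using (_≡_; _≢_)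

Family : ℕ → Set
Family n = Subset n → Bool

allSubsets : (n : ℕ) → List (Subset n)
allSubsets zero = [] ∷ []
allSubsets (suc n) = map (outside ∷_) (allSubsets n) ++ map (inside ∷_) (allSubsets n)

_≟ₛ_ : {n : ℕ} → (p q : Subset n) → Dec (p ≡ q)
_≟ₛ_ = ≡-dec BoolP._≟_

members : {n : ℕ} → Family n → List (Subset n)
members {n} F = filterᵇ F (allSubsets n)

card : {n : ℕ} → Family n → ℕ
card F = length (members F)

UnionClosed : {n : ℕ} → Family n → Set
UnionClosed {n} F = (A B : Subset n) → F A ≡ true → F B ≡ true → F (A ∪ B) ≡ true

unionBelow : {n : ℕ} → Family n → Subset n → Subset n
unionBelow F V = ⋃ (filterᵇ (λ W → does (W ⊂? V)) (members F))

isJ : {n : ℕ} → Family n → Subset n → Bool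
isJ F V = F V ∧ not (does (V ≟ₛ ⊥)) ∧ not (does (V ≟ₛ unionBelow F V))

meets : {n : ℕ} → Subset n → Subset n → Bool
meets V Z = not (does ((V ∩ Z) ≟ₛ ⊥))

Nbh : {n : ℕ} → Family n → Subset n → Subset n
Nbh {n} F Z = Z ∪ ⋃ (filterᵇ (λ V → isJ F V ∧ meets V Z) (allSubsets n))

π : {n : ℕ} → Family n → Subset n → Subset n
π F Z = ⋃ (filterᵇ (λ V → does (V ⊆? Z)) (members F))

-- 𝒩_F(W) for W given as a predicate on Fin n: T is in 𝒩_F(W) iff T is the union of
-- a (finite) subfamily of {V ∈ J(F) : V ∩ W ≠ ∅}  (empty union = ∅)
𝒩 : {n : ℕ} → Family n → (Fin n → Set) → Subset n → Set
𝒩 {n} F W T = Σ (List (Subset n)) λ S →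
  All (λ V → (isJ F V ≡ true) × ∃ λ x → x ∈ V × W x) S × ⋃ S ≡ T

⋃Fam : {n : ℕ} → (Subset n → Set) → Fin n → Set
⋃Fam {n} 𝒢 x = ∃ λ (T : Subset n) → 𝒢 T × x ∈ T

𝒩³ : {n : ℕ} → Family n → Subset n → Subset n → Set
𝒩³ F U = 𝒩 F (⋃Fam (𝒩 F (λ x → x ∈ U)))

inE : {n : ℕ} → Family n → Subset n → Subset n → Subset n → Bool
inE F U X W = does (W ⊆? U)
  ∧ does ((π F (X ∪ W) ∩ U) ≟ₛ W)
  ∧ does ((π F (X ∪ U) ─ U) ⊆? π F (X ∪ W))

E : {n : ℕ} → Family n → Subset n → Subset n → Family n
E F U X = inE F U X

Minimal : {n : ℕ} → Family n → Subset n → Set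
Minimal {n} H X = H X ≡ true × ((Y : Subset n) → H Y ≡ true → Y ⊂ X → ⊥₀)

-- For a minimal X ∈ H, let W be the set of points p ∈ U with p ∈ π(X ∪ {p}).  Each
-- point of π(X ∪ U) outside U lies in a union generator V ⊆ X ∪ U (members of F are
-- unions of generators, as F ⊆ 𝒩³(U)); since |V| ≤ 2 and V already has a point outside
-- U, V meets U in at most one point p, and then V ⊆ X ∪ {p} puts p into W.  Hence
-- W ∈ E(X), as is U, so |E(X)| = 1 forces W = U.  Monotonicity of π carries
-- p ∈ π(X ∪ {p}) from a minimal member of H up to every member, and since X is disjoint
-- from U this gives π(X ∪ Y) ∩ U = Y.
module Submission where

open import Defs
open import Data.Nat using (ℕ)
open import Data.Bool using (true)
open import Data.Fin using (Fin)
open import Data.Fin.Subset using (Subset; _∪_; _∩_; _─_; _⊆_; ⊥; ⁅_⁆; ∣_∣)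
open import Data.Sum using (_⊎_)
open import Data.Product using (∃; _×_)
open import Relation.Binary.PropositionalEquality using (_≡_; _≢_)

open import Data.Fin using (_≟_)
open import Data.Nat using (zero; suc; _≤_; s≤s; z≤n)
open import Data.Nat.Properties using (≤-trans; ≤-reflexive)
open import Data.Bool using (Bool; T?)
open import Data.Bool.Properties using (T-≡) renaming (_≟_ to _≟ᵇ_)
open import Data.Fin.Subset using (_∈_; _∉_; _⊂_; _-_; inside; outside; ⋃)
open import Data.Fin.Subset.Properties
open import Data.Fin.Subset.Induction using (⊂-wellFounded; Acc; acc)
open import Data.List using (List; []; _∷_; length; filterᵇ)
open import Data.List.Relation.Unary.All as All using ()
open import Data.List.Relation.Unary.Any as Any using (any?; satisfied)
open import Data.List.Membership.Propositional using (lose) renaming (_∈_ to _∈ₗ_)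
open import Data.List.Membership.Propositional.Properties
  using (∈-map⁺; ∈-++⁺ˡ; ∈-++⁺ʳ; ∈-filter⁺; ∈-filter⁻)
open import Data.Vec using ([]; _∷_; tabulate; here; there)
open import Data.Vec.Properties using (lookup∘tabulate; lookup⇒[]=; []=⇒lookup)
open import Data.Product using (_,_; proj₁; proj₂)
open import Data.Sum using (inj₁; inj₂; [_,_]′)
open import Data.Empty using () renaming (⊥ to ⊥₀)
open import Function using (_∘_; Equivalence)
open import Relation.Nullary using (Dec; yes; no; does; contradiction)
open import Relation.Nullary.Decidable using (_×-dec_; dec-true)
open import Relation.Binary.PropositionalEquality using (refl; sym; trans; subst)

private
  variable
    n : ℕ
    x y z : Fin n
    p q r : Subset n

x∈p─q⇒x∉q : ∀ (p q : Subset n) → x ∈ p ─ q → x ∉ q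
x∈p─q⇒x∉q (_ ∷ p) (_ ∷ q) (there x∈) (there x∈q) = x∈p─q⇒x∉q p q x∈ x∈q
x∈p─q⇒x∉q (_ ∷ p) (inside ∷ q) () here

∪-mono-⊆ : ∀ {p q r s : Subset n} → p ⊆ q → r ⊆ s → p ∪ r ⊆ q ∪ s
∪-mono-⊆ {p = p} {r = r} p⊆q r⊆s x∈ with x∈p∪q⁻ p r x∈
... | inj₁ x∈p = x∈p∪q⁺ (inj₁ (p⊆q x∈p))
... | inj₂ x∈r = x∈p∪q⁺ (inj₂ (r⊆s x∈r))

⁅x⁆⊆p : x ∈ p → ⁅ x ⁆ ⊆ p
⁅x⁆⊆p {x = x} {p = p} x∈p y∈ = subst (_∈ p) (sym (x∈⁅y⁆⇒x≡y x y∈)) x∈p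

∈⋃⁻ : ∀ (ps : List (Subset n)) → x ∈ ⋃ ps → ∃ λ p → p ∈ₗ ps × x ∈ p
∈⋃⁻ []       x∈ = contradiction x∈ ∉⊥
∈⋃⁻ (p ∷ ps) x∈ with x∈p∪q⁻ p (⋃ ps) x∈
... | inj₁ x∈p  = p , Any.here refl , x∈p
... | inj₂ x∈ps with ∈⋃⁻ ps x∈ps
...   | q , q∈ , x∈q = q , Any.there q∈ , x∈q

∈⋃⁺ : ∀ (ps : List (Subset n)) → p ∈ₗ ps → x ∈ p → x ∈ ⋃ ps
∈⋃⁺ (_ ∷ ps) (Any.here refl) x∈p = x∈p∪q⁺ (inj₁ x∈p)
∈⋃⁺ (q ∷ ps) (Any.there p∈)  x∈p = x∈p∪q⁺ (inj₂ (∈⋃⁺ ps p∈ x∈p))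

∈tabulate⁺ : ∀ (f : Fin n → Bool) → f x ≡ true → x ∈ tabulate f
∈tabulate⁺ {x = x} f fx = lookup⇒[]= x (tabulate f) (trans (lookup∘tabulate f x) fx)

∈tabulate⁻ : ∀ (f : Fin n → Bool) → x ∈ tabulate f → f x ≡ true
∈tabulate⁻ {x = x} f x∈ = trans (sym (lookup∘tabulate f x)) ([]=⇒lookup x∈)

∈-allSubsets : ∀ n (p : Subset n) → p ∈ₗ allSubsets n
∈-allSubsets zero    []            = Any.here refl
∈-allSubsets (suc n) (outside ∷ p) = ∈-++⁺ˡ (∈-map⁺ (outside ∷_) (∈-allSubsets n p))
∈-allSubsets (suc n) (inside ∷ p)  =
  ∈-++⁺ʳ _ (∈-map⁺ (inside ∷_) (∈-allSubsets n p))

∈-filterᵇ⁺ : ∀ {A : Set} (f : A → Bool) {a} {xs : List A} →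
             a ∈ₗ xs → f a ≡ true → a ∈ₗ filterᵇ f xs
∈-filterᵇ⁺ f a∈ fa = ∈-filter⁺ (T? ∘ f) a∈ (Equivalence.from T-≡ fa)

∈-filterᵇ⁻ : ∀ {A : Set} (f : A → Bool) (xs : List A) {a} →
             a ∈ₗ filterᵇ f xs → a ∈ₗ xs × f a ≡ true
∈-filterᵇ⁻ f xs a∈ with ∈-filter⁻ (T? ∘ f) {xs = xs} a∈
... | a∈xs , T-fa = a∈xs , Equivalence.to T-≡ T-fa

does≡true⇒ : ∀ {P : Set} (P? : Dec P) → does P? ≡ true → P
does≡true⇒ (yes p) _ = p

∈-members⁺ : ∀ (F : Family n) → F p ≡ true → p ∈ₗ members F
∈-members⁺ {n} {p} F = ∈-filterᵇ⁺ F (∈-allSubsets n p)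

∈-members⁻ : ∀ (F : Family n) → p ∈ₗ members F → F p ≡ true
∈-members⁻ {n} F p∈ = proj₂ (∈-filterᵇ⁻ F (allSubsets n) p∈)

length≡1⇒∈-unique : ∀ {A : Set} {a b : A} (xs : List A) →
                    length xs ≡ 1 → a ∈ₗ xs → b ∈ₗ xs → a ≡ b
length≡1⇒∈-unique (_ ∷ []) _ (Any.here refl) (Any.here refl) = refl

card≡1⇒unique : ∀ (G : Family n) → card G ≡ 1 → G p ≡ true → G q ≡ true → p ≡ q
card≡1⇒unique G card≡1 Gp Gq =
  length≡1⇒∈-unique (members G) card≡1 (∈-members⁺ G Gp) (∈-members⁺ G Gq)

∣p∣≤2⇒¬three-distinct : ∣ p ∣ ≤ 2 → x ∈ p → y ∈ p → z ∈ p →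
                        x ≢ y → z ≢ x → z ≢ y → ⊥₀
∣p∣≤2⇒¬three-distinct {p = p} {x} {y} {z} ∣p∣≤2 x∈ y∈ z∈ x≢y z≢x z≢y
  with ≤-trans three≤∣p∣ ∣p∣≤2
  where
  y∈p-x : y ∈ p - x
  y∈p-x = x∈p∧x≢y⇒x∈p-y y∈ (x≢y ∘ sym)
  z∈p-x-y : z ∈ p - x - y
  z∈p-x-y = x∈p∧x≢y⇒x∈p-y (x∈p∧x≢y⇒x∈p-y z∈ z≢x) z≢y
  three≤∣p∣ : 3 ≤ ∣ p ∣
  three≤∣p∣ = ≤-trans (s≤s (s≤s (≤-trans (s≤s z≤n) (x∈p⇒∣p-x∣<∣p∣ z∈p-x-y))))
                (≤-trans (s≤s (x∈p⇒∣p-x∣<∣p∣ y∈p-x)) (x∈p⇒∣p-x∣<∣p∣ x∈))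
... | s≤s (s≤s ())

minimal-below : ∀ (H : Family n) {X} → Acc _⊂_ X → H X ≡ true →
                ∃ λ X₀ → Minimal H X₀ × X₀ ⊆ X
minimal-below {n} H {X} (acc rs) HX
  with any? (λ Y → (H Y ≟ᵇ true) ×-dec (Y ⊂? X)) (allSubsets n)
... | yes smaller with satisfied smaller
...   | Y , HY , Y⊂X with minimal-below H (rs Y⊂X) HY
...     | X₀ , X₀-min , X₀⊆Y = X₀ , X₀-min , ⊆-trans X₀⊆Y (p⊂q⇒p⊆q Y⊂X)
minimal-below {n} H {X} (acc rs) HX | no none =
  X , (HX , λ Y HY Y⊂X → none (lose (∈-allSubsets n Y) (HY , Y⊂X))) , ⊆-refl

module _ (F : Family n) where

  ∈π⁻ : ∀ Z → x ∈ π F Z → ∃ λ V → F V ≡ true × V ⊆ Z × x ∈ V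
  ∈π⁻ Z x∈ with ∈⋃⁻ _ x∈
  ... | V , V∈ , x∈V with ∈-filterᵇ⁻ (λ V → does (V ⊆? Z)) (members F) V∈
  ...   | V∈F , V⊆Z = V , ∈-members⁻ F V∈F , does≡true⇒ (V ⊆? Z) V⊆Z , x∈V

  ∈π⁺ : ∀ Z {V} → F V ≡ true → V ⊆ Z → x ∈ V → x ∈ π F Z
  ∈π⁺ Z {V} FV V⊆Z =
    ∈⋃⁺ _ (∈-filterᵇ⁺ (λ V → does (V ⊆? Z)) (∈-members⁺ F FV) (dec-true (V ⊆? Z) V⊆Z))

  π⊆ : ∀ Z → π F Z ⊆ Z
  π⊆ Z x∈ with ∈π⁻ Z x∈
  ... | V , _ , V⊆Z , x∈V = V⊆Z x∈V

  π-mono : q ⊆ r → π F q ⊆ π F r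
  π-mono {q = q} {r = r} q⊆r x∈ with ∈π⁻ q x∈
  ... | V , FV , V⊆q , x∈V = ∈π⁺ r FV (⊆-trans V⊆q q⊆r) x∈V

  isJ⇒∈ : ∀ V → isJ F V ≡ true → F V ≡ true
  isJ⇒∈ V JV with F V
  ... | true = refl

  JCovered : Set
  JCovered = ∀ T → F T ≡ true → ∀ {x} → x ∈ T → ∃ λ V → isJ F V ≡ true × V ⊆ T × x ∈ V

  𝒩⇒JCovered : ∀ (W : Fin n → Set) → (∀ T → F T ≡ true → 𝒩 F W T) → JCovered
  𝒩⇒JCovered W F⊆𝒩 T FT x∈T with F⊆𝒩 T FT
  ... | S , S-gen , refl with ∈⋃⁻ S x∈T
  ...   | V , V∈S , x∈V = V , proj₁ (All.lookup S-gen V∈S) , (λ y∈ → ∈⋃⁺ S V∈S y∈) , x∈V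

  ∈π⇒J-witness : JCovered → ∀ Z → x ∈ π F Z → ∃ λ V → isJ F V ≡ true × V ⊆ Z × x ∈ V
  ∈π⇒J-witness covered Z x∈ with ∈π⁻ Z x∈
  ... | T , FT , T⊆Z , x∈T with covered T FT x∈T
  ...   | V , JV , V⊆T , x∈V = V , JV , ⊆-trans V⊆T T⊆Z , x∈V

  module _ (U X : Subset n) (X∩U≡∅ : ∀ {x} → x ∈ X → x ∉ U) where

    π-trace : q ⊆ U → q ⊆ π F (X ∪ q) → π F (X ∪ q) ∩ U ≡ q
    π-trace {q = q} q⊆U q⊆π = ⊆-antisym trace⊆q (λ x∈q → x∈p∩q⁺ (q⊆π x∈q , q⊆U x∈q))
      where
      trace⊆q : π F (X ∪ q) ∩ U ⊆ q
      trace⊆q x∈ with x∈p∩q⁻ _ U x∈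
      ... | x∈π , x∈U with x∈p∪q⁻ X q (π⊆ (X ∪ q) x∈π)
      ...   | inj₁ x∈X = contradiction x∈U (X∩U≡∅ x∈X)
      ...   | inj₂ x∈q = x∈q

    ∈E⁺ : q ⊆ U → q ⊆ π F (X ∪ q) → π F (X ∪ U) ─ U ⊆ π F (X ∪ q) → E F U X q ≡ true
    ∈E⁺ {q = q} q⊆U q⊆π outside⊆π
      rewrite dec-true (q ⊆? U) q⊆U
            | dec-true ((π F (X ∪ q) ∩ U) ≟ₛ q) (π-trace q⊆U q⊆π)
            | dec-true (π F (X ∪ U) ─ U ⊆? π F (X ∪ q)) outside⊆π = refl

    U∈E : F U ≡ true → E F U X U ≡ true
    U∈E FU = ∈E⁺ ⊆-refl (∈π⁺ (X ∪ U) FU (q⊆p∪q X U)) (p─q⊆p _ U)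

    selfSpanned : Subset n
    selfSpanned = U ∩ tabulate (λ p → does (p ∈? π F (X ∪ ⁅ p ⁆)))

    ∈selfSpanned⁺ : x ∈ U → x ∈ π F (X ∪ ⁅ x ⁆) → x ∈ selfSpanned
    ∈selfSpanned⁺ {x = x} x∈U x∈π =
      x∈p∩q⁺ (x∈U , ∈tabulate⁺ _ (dec-true (x ∈? π F (X ∪ ⁅ x ⁆)) x∈π))

    ∈selfSpanned⁻ : x ∈ selfSpanned → x ∈ π F (X ∪ ⁅ x ⁆)
    ∈selfSpanned⁻ {x = x} x∈ =
      does≡true⇒ (x ∈? π F (X ∪ ⁅ x ⁆)) (∈tabulate⁻ _ (proj₂ (x∈p∩q⁻ U _ x∈)))

    module _ (covered : JCovered)
             (J-small : ∀ V → isJ F V ≡ true → ∣ V ∣ ≤ 2) where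

      J-absorbed : ∀ {V} → isJ F V ≡ true → V ⊆ X ∪ U → z ∈ V → z ∉ U →
                   y ∈ V → y ∈ U → V ⊆ X ∪ ⁅ y ⁆
      J-absorbed {y = y} {V} JV V⊆ z∈V z∉U y∈V y∈U {w} w∈V with x∈p∪q⁻ X U (V⊆ w∈V)
      ... | inj₁ w∈X = x∈p∪q⁺ (inj₁ w∈X)
      ... | inj₂ w∈U with w ≟ y
      ...   | yes refl = x∈p∪q⁺ (inj₂ (x∈⁅x⁆ y))
      ...   | no w≢y  = contradiction (J-small V JV) λ ∣V∣≤2 →
        ∣p∣≤2⇒¬three-distinct ∣V∣≤2 w∈V y∈V z∈V w≢y
          (λ z≡w → z∉U (subst (_∈ U) (sym z≡w) w∈U))
          (λ z≡y → z∉U (subst (_∈ U) (sym z≡y) y∈U))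

      selfSpanned∈E : E F U X selfSpanned ≡ true
      selfSpanned∈E = ∈E⁺ (p∩q⊆p U _) spanned outside⊆π
        where
        spanned : selfSpanned ⊆ π F (X ∪ selfSpanned)
        spanned x∈ = π-mono (∪-mono-⊆ ⊆-refl (⁅x⁆⊆p x∈)) (∈selfSpanned⁻ x∈)
        outside⊆π : π F (X ∪ U) ─ U ⊆ π F (X ∪ selfSpanned)
        outside⊆π {z} z∈ with ∈π⇒J-witness covered (X ∪ U) (p─q⊆p _ U z∈)
        ... | V , JV , V⊆ , z∈V = ∈π⁺ (X ∪ selfSpanned) (isJ⇒∈ V JV) V⊆X∪selfSpanned z∈V
          where
          V⊆X∪selfSpanned : V ⊆ X ∪ selfSpanned
          V⊆X∪selfSpanned w∈V with x∈p∪q⁻ X U (V⊆ w∈V)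
          ... | inj₁ w∈X = x∈p∪q⁺ (inj₁ w∈X)
          ... | inj₂ w∈U = x∈p∪q⁺ (inj₂ (∈selfSpanned⁺ w∈U
                (∈π⁺ _ (isJ⇒∈ V JV)
                  (J-absorbed JV V⊆ z∈V (x∈p─q⇒x∉q _ U z∈) w∈V w∈U) w∈V)))

      ∈π-point : F U ≡ true → card (E F U X) ≡ 1 → x ∈ U → x ∈ π F (X ∪ ⁅ x ⁆)
      ∈π-point FU card≡1 x∈U = ∈selfSpanned⁻ (subst (_ ∈_) (sym selfSpanned≡U) x∈U)
        where
        selfSpanned≡U : selfSpanned ≡ U
        selfSpanned≡U = card≡1⇒unique (E F U X) card≡1 selfSpanned∈E (U∈E FU)

corollary3p22 : (n : ℕ) (F : Family n) (a b : Fin n) →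
  let U = ⁅ a ⁆ ∪ ⁅ b ⁆
      N = Nbh F U
      N² = Nbh F N
  in UnionClosed F →
     F ⊥ ≡ true →
     ((V : Subset n) → isJ F V ≡ true → (∣ V ∣ ≡ 1) ⊎ (∣ V ∣ ≡ 2)) →
     a ≢ b →
     isJ F U ≡ true →
     ((T : Subset n) → F T ≡ true → 𝒩³ F U T) →
     ((T : Subset n) → 𝒩³ F U T → F T ≡ true) →
     (H : Family n) →
     ((X : Subset n) → H X ≡ true → X ⊆ (N² ─ U)) →
     ((X Y : Subset n) → H X ≡ true → X ⊆ Y → Y ⊆ (N² ─ U) → H Y ≡ true) →
     (∃ λ X → H X ≡ true) →
     ((X : Subset n) → Minimal H X → card (E F U X) ≡ 1) →
     (X Y : Subset n) → H X ≡ true → Y ⊆ U →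
     (π F (X ∪ Y) ∩ U) ≡ Y
corollary3p22 n F a b _ _ J-size _ JU F⊆𝒩³ _ H H⊆N²─U _ _ E-single X Y HX Y⊆U =
  π-trace F U X (disjoint HX) Y⊆U Y⊆π
  where
  U = ⁅ a ⁆ ∪ ⁅ b ⁆
  disjoint : ∀ {X} → H X ≡ true → ∀ {x} → x ∈ X → x ∉ U
  disjoint HX x∈X = x∈p─q⇒x∉q _ U (H⊆N²─U _ HX x∈X)
  J-small : ∀ V → isJ F V ≡ true → ∣ V ∣ ≤ 2
  J-small V JV = [ (λ ∣V∣≡1 → ≤-trans (≤-reflexive ∣V∣≡1) (s≤s z≤n)) , ≤-reflexive ]′ (J-size V JV)
  Y⊆π : Y ⊆ π F (X ∪ Y)
  Y⊆π y∈Y with minimal-below H (⊂-wellFounded X) HX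
  ... | X₀ , X₀-min , X₀⊆X =
    π-mono F (∪-mono-⊆ X₀⊆X (⁅x⁆⊆p y∈Y))
      (∈π-point F U X₀ (disjoint (proj₁ X₀-min)) (𝒩⇒JCovered F _ F⊆𝒩³) J-small
        (isJ⇒∈ F U JU) (E-single X₀ X₀-min) (Y⊆U y∈Y))
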